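{- For every finite simple graph $G$ with minimum degree $\delta(G)$ and every positive integer $k$, $$d_R^k(G)\le \delta(G)+2k.$$ Moreover, the upper bound is sharp: for every positive integer $k$ there exists a graph $G$ with $d_R^k(G)=\delta(G)+2k$.
   Context: Let $k\ge1$ be an integer. A Roman $k$-dominating function (RkDF) on a graph $G$ is a map $f:V(G)\to\{0,1,2\}$ such that every vertex $v$ with $f(v)=0$ has at least $k$ neighbors $u$ with $f(u)=2$. A set $\{f_1,\ldots,f_d\}$ of pairwise distinct RkDFs on $G$ with $\sum_{i=1}^d f_i(v)\le 2k$ for every $v\in V(G)$ is a Roman $(k,k)$-dominating family on $G$; the maximum number of functions in such a family is the Roman $(k,k)$-domatic number $d_R^k(G)$. -}

module Defs where

open import Data.Nat using (ℕ; zero; suc; _+_; _≤_; _⊓_)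
open import Data.Fin using (Fin; toℕ)
import Data.Fin as F
open import Data.Bool using (Bool; true; false; if_then_else_; _∧_)
open import Data.Product using (Σ; _×_; _,_)
open import Relation.Binary.PropositionalEquality using (_≡_; _≢_)
open import Relation.Nullary using (¬_)

sumFin : (n : ℕ) → (Fin n → ℕ) → ℕ
sumFin zero    f = 0
sumFin (suc n) f = f F.zero + sumFin n (λ i → f (F.suc i))

minFin : (n : ℕ) → (Fin (suc n) → ℕ) → ℕ
minFin zero    f = f F.zero
minFin (suc n) f = f F.zero ⊓ minFin n (λ i → f (F.suc i))

record Graph (n : ℕ) : Set where
  field
    Adj   : Fin n → Fin n → Bool
    sym   : ∀ u v → Adj u v ≡ Adj v u
    irrfl : ∀ v → Adj v v ≡ false
open Graph public

indicator : Bool → ℕ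
indicator true  = 1
indicator false = 0

deg : ∀ {n} → Graph n → Fin n → ℕ
deg {n} G v = sumFin n (λ u → indicator (Adj G v u))

δ : ∀ {n} → Graph (suc n) → ℕ
δ {n} G = minFin n (deg G)

-- values {0,1,2} are represented by Fin 3; value read off via toℕ
is2 : Fin 3 → Bool
is2 F.zero = false
is2 (F.suc F.zero) = false
is2 (F.suc (F.suc F.zero)) = true

IsRkDF : ∀ {n} → Graph n → ℕ → (Fin n → Fin 3) → Set
IsRkDF {n} G k f =
  ∀ v → toℕ (f v) ≡ 0 → k ≤ sumFin n (λ u → indicator (Adj G v u ∧ is2 (f u)))

IsRkkFamily : ∀ {n} → Graph n → ℕ → (d : ℕ) → (Fin d → Fin n → Fin 3) → Set
IsRkkFamily {n} G k d fs =
    (∀ i → IsRkDF G k (fs i))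
  × (∀ i j → i ≢ j → ¬ (∀ v → fs i v ≡ fs j v))
  × (∀ v → sumFin d (λ i → toℕ (fs i v)) ≤ k + k)

IsRomanKDomaticNumber : ∀ {n} → Graph n → ℕ → ℕ → Set
IsRomanKDomaticNumber {n} G k d =
    Σ (Fin d → Fin n → Fin 3) (λ fs → IsRkkFamily G k d fs)
  × (∀ d' (fs : Fin d' → Fin n → Fin 3) → IsRkkFamily G k d' fs → d' ≤ d)

module Submission where

-- Let v be a vertex of minimum degree and f₁,…,f_d a Roman
-- (k,k)-dominating family.  For every i,
--     k ≤ #{u ∈ N(v) : fᵢ(u) = 2} + fᵢ(v)·k,
-- because either fᵢ(v) = 0 and v has k neighbours labelled 2, or fᵢ(v) ≥ 1.
-- Summing over i gives  d·k ≤ Σ_{u ∈ N(v)} #{i : fᵢ(u) = 2} + (Σᵢ fᵢ(v))·k.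
-- Each vertex u carries the label 2 in at most k functions (since the
-- labels at u add up to at most 2k), and Σᵢ fᵢ(v) ≤ 2k, so
-- d·k ≤ deg(v)·k + 2k·k; cancelling k ≥ 1 gives d ≤ δ(G) + 2k.
--
-- Take an isolated vertex w together with the complete
-- 2k-partite graph with parts P₁,…,P₂ₖ of size k.  Then δ = 0, and the
-- functions fᵢ (w ↦ 1, Pᵢ ↦ 2, all other vertices ↦ 0) form a Roman
-- (k,k)-dominating family of size 2k; by the upper bound it is maximum.

open import Defs hiding (sym)
open import Data.Nat using (ℕ; zero; suc; _+_; _*_; _≤_; z≤n; s≤s; NonZero)
open import Data.Nat.Properties hiding (_≟_)
open import Algebra.Properties.Semiring.Sum +-*-semiring
  using (sum; sum-cong-≗; ∑-comm; ∑-distrib-+; *-distribˡ-sum; *-distribʳ-sum)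
open import Data.Fin using (Fin; toℕ; _↑ˡ_; _↑ʳ_; combine; remQuot; _≟_)
import Data.Fin as F
open import Data.Fin.Properties using (remQuot-combine)
open import Data.Bool using (Bool; true; false; if_then_else_; _∧_; not)
open import Data.Product using (Σ; _×_; _,_; proj₁; proj₂)
open import Data.Sum using (inj₁; inj₂)
open import Function.Bundles using (mk⇔)
open import Relation.Binary.PropositionalEquality
open import Relation.Nullary using (¬_; does; yes; no)
open import Relation.Nullary.Decidable using (dec-true; dec-false; does-⇔)

sumFin≡sum : ∀ n (f : Fin n → ℕ) → sumFin n f ≡ sum f
sumFin≡sum zero    f = refl
sumFin≡sum (suc n) f = cong (f F.zero +_) (sumFin≡sum n (λ i → f (F.suc i)))

sumFin-cong : ∀ n {f g : Fin n → ℕ} → (∀ i → f i ≡ g i) → sumFin n f ≡ sumFin n g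
sumFin-cong n {f} {g} f≗g =
  trans (sumFin≡sum n f) (trans (sum-cong-≗ f≗g) (sym (sumFin≡sum n g)))

sumFin-+ : ∀ n (f g : Fin n → ℕ) →
  sumFin n (λ i → f i + g i) ≡ sumFin n f + sumFin n g
sumFin-+ n f g = begin
  sumFin n (λ i → f i + g i)  ≡⟨ sumFin≡sum n _ ⟩
  sum (λ i → f i + g i)       ≡⟨ ∑-distrib-+ f g ⟩
  sum f + sum g               ≡⟨ cong₂ _+_ (sumFin≡sum n f) (sumFin≡sum n g) ⟨
  sumFin n f + sumFin n g     ∎
  where open ≡-Reasoning

sumFin-*ˡ : ∀ n c (f : Fin n → ℕ) → sumFin n (λ i → c * f i) ≡ c * sumFin n f
sumFin-*ˡ n c f = begin
  sumFin n (λ i → c * f i)  ≡⟨ sumFin≡sum n _ ⟩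
  sum (λ i → c * f i)       ≡⟨ *-distribˡ-sum c f ⟨
  c * sum f                 ≡⟨ cong (c *_) (sumFin≡sum n f) ⟨
  c * sumFin n f            ∎
  where open ≡-Reasoning

sumFin-*ʳ : ∀ n c (f : Fin n → ℕ) → sumFin n (λ i → f i * c) ≡ sumFin n f * c
sumFin-*ʳ n c f = begin
  sumFin n (λ i → f i * c)  ≡⟨ sumFin≡sum n _ ⟩
  sum (λ i → f i * c)       ≡⟨ *-distribʳ-sum c f ⟨
  sum f * c                 ≡⟨ cong (_* c) (sumFin≡sum n f) ⟨
  sumFin n f * c            ∎
  where open ≡-Reasoning

sumFin-comm : ∀ m n (f : Fin m → Fin n → ℕ) →
  sumFin m (λ i → sumFin n (f i)) ≡ sumFin n (λ j → sumFin m (λ i → f i j))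
sumFin-comm m n f = begin
  sumFin m (λ i → sumFin n (f i))          ≡⟨ sumFin≡sum m _ ⟩
  sum (λ i → sumFin n (f i))               ≡⟨ sum-cong-≗ (λ i → sumFin≡sum n (f i)) ⟩
  sum (λ i → sum (f i))                    ≡⟨ ∑-comm f ⟩
  sum (λ j → sum (λ i → f i j))            ≡⟨ sum-cong-≗ (λ j → sumFin≡sum m (λ i → f i j)) ⟨
  sum (λ j → sumFin m (λ i → f i j))       ≡⟨ sumFin≡sum n _ ⟨
  sumFin n (λ j → sumFin m (λ i → f i j))  ∎
  where open ≡-Reasoning

sumFin-const : ∀ n c → sumFin n (λ _ → c) ≡ n * c
sumFin-const zero    c = refl
sumFin-const (suc n) c = cong (c +_) (sumFin-const n c)

sumFin-mono : ∀ n {f g : Fin n → ℕ} → (∀ i → f i ≤ g i) → sumFin n f ≤ sumFin n g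
sumFin-mono zero    f≤g = z≤n
sumFin-mono (suc n) f≤g = +-mono-≤ (f≤g F.zero) (sumFin-mono n (λ i → f≤g (F.suc i)))

term≤sumFin : ∀ n (f : Fin n → ℕ) i → f i ≤ sumFin n f
term≤sumFin (suc n) f F.zero    = m≤m+n _ _
term≤sumFin (suc n) f (F.suc i) = ≤-trans (term≤sumFin n (λ j → f (F.suc j)) i) (m≤n+m _ _)

sumFin-↑ : ∀ m n (g : Fin (m + n) → ℕ) →
  sumFin (m + n) g ≡ sumFin m (λ i → g (i ↑ˡ n)) + sumFin n (λ j → g (m ↑ʳ j))
sumFin-↑ zero    n g = refl
sumFin-↑ (suc m) n g =
  trans (cong (g F.zero +_) (sumFin-↑ m n (λ i → g (F.suc i)))) (sym (+-assoc (g F.zero) _ _))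

sumFin-combine : ∀ a b (g : Fin (a * b) → ℕ) →
  sumFin (a * b) g ≡ sumFin a (λ x → sumFin b (λ j → g (combine x j)))
sumFin-combine zero    b g = refl
sumFin-combine (suc a) b g =
  trans (sumFin-↑ b (a * b) g)
        (cong (sumFin b (λ j → g (j ↑ˡ (a * b))) +_) (sumFin-combine a b (λ y → g (b ↑ʳ y))))

sumFin-delta : ∀ n (x : Fin n) c → sumFin n (λ i → if does (x ≟ i) then c else 0) ≡ c
sumFin-delta (suc n) F.zero c = begin
  c + sumFin n (λ i → if does (F.zero ≟ F.suc i) then c else 0)  ≡⟨⟩
  c + sumFin n (λ _ → 0)                                         ≡⟨ cong (c +_) (sumFin-const n 0) ⟩
  c + n * 0                                                      ≡⟨ cong (c +_) (*-zeroʳ n) ⟩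
  c + 0                                                          ≡⟨ +-identityʳ c ⟩
  c                                                              ∎
  where open ≡-Reasoning
sumFin-delta (suc n) (F.suc x) c = sumFin-delta n x c

minFin-attained : ∀ m (f : Fin (suc m) → ℕ) → Σ (Fin (suc m)) λ v → minFin m f ≡ f v
minFin-attained zero    f = F.zero , refl
minFin-attained (suc m) f
  with minFin-attained m (λ i → f (F.suc i)) | ≤-total (f F.zero) (minFin m (λ i → f (F.suc i)))
... | _ , _      | inj₁ f₀≤min = F.zero  , m≤n⇒m⊓n≡m f₀≤min
... | v , min≡fv | inj₂ min≤f₀ = F.suc v , trans (m≥n⇒m⊓n≡n min≤f₀) min≡fv

minFin-zero : ∀ m (f : Fin (suc m) → ℕ) → f F.zero ≡ 0 → minFin m f ≡ 0
minFin-zero zero    f f₀≡0 = f₀≡0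
minFin-zero (suc m) f f₀≡0 rewrite f₀≡0 = refl

indicator-∧ : ∀ a b → indicator (a ∧ b) ≡ indicator a * indicator b
indicator-∧ true  b = sym (+-identityʳ (indicator b))
indicator-∧ false b = refl

twice-is2≤label : ∀ x → 2 * indicator (is2 x) ≤ toℕ x
twice-is2≤label F.zero                 = z≤n
twice-is2≤label (F.suc F.zero)         = z≤n
twice-is2≤label (F.suc (F.suc F.zero)) = ≤-refl

twoNeighbours : ∀ {n} → Graph n → (Fin n → Fin 3) → Fin n → ℕ
twoNeighbours {n} G f v = sumFin n (λ u → indicator (Adj G v u ∧ is2 (f u)))

rkdf-local : ∀ {n} (G : Graph n) k f → IsRkDF G k f →
  ∀ v → k ≤ twoNeighbours G f v + toℕ (f v) * k
rkdf-local G k f isR v with f v in fv≡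
... | F.zero  = ≤-trans (isR v (cong toℕ fv≡)) (≤-reflexive (sym (+-identityʳ _)))
... | F.suc _ = ≤-trans (m≤m+n k _) (m≤n+m _ (twoNeighbours G f v))

twos-at-vertex≤ : ∀ {n} k d (fs : Fin d → Fin n → Fin 3) →
  (∀ u → sumFin d (λ i → toℕ (fs i u)) ≤ k + k) →
  ∀ u → sumFin d (λ i → indicator (is2 (fs i u))) ≤ k
twos-at-vertex≤ k d fs weight≤ u = *-cancelˡ-≤ 2 (begin
  2 * sumFin d (λ i → indicator (is2 (fs i u)))  ≡⟨ sumFin-*ˡ d 2 _ ⟨
  sumFin d (λ i → 2 * indicator (is2 (fs i u)))  ≤⟨ sumFin-mono d (λ i → twice-is2≤label (fs i u)) ⟩
  sumFin d (λ i → toℕ (fs i u))                  ≤⟨ weight≤ u ⟩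
  k + k                                          ≡⟨ cong (k +_) (+-identityʳ k) ⟨
  2 * k                                          ∎)
  where open ≤-Reasoning

-- Double counting the pairs (i, u) with u ∈ N(v) and fᵢ(u) = 2.
twoNeighbours-total≤ : ∀ {n} (G : Graph n) k d (fs : Fin d → Fin n → Fin 3) →
  (∀ u → sumFin d (λ i → indicator (is2 (fs i u))) ≤ k) →
  ∀ v → sumFin d (λ i → twoNeighbours G (fs i) v) ≤ deg G v * k
twoNeighbours-total≤ {n} G k d fs twos≤ v = begin
  sumFin d (λ i → sumFin n (λ u → indicator (Adj G v u ∧ is2 (fs i u))))
    ≡⟨ sumFin-cong d (λ i → sumFin-cong n (λ u → indicator-∧ (Adj G v u) (is2 (fs i u)))) ⟩
  sumFin d (λ i → sumFin n (λ u → a u * indicator (is2 (fs i u))))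
    ≡⟨ sumFin-comm d n _ ⟩
  sumFin n (λ u → sumFin d (λ i → a u * indicator (is2 (fs i u))))
    ≡⟨ sumFin-cong n (λ u → sumFin-*ˡ d (a u) _) ⟩
  sumFin n (λ u → a u * sumFin d (λ i → indicator (is2 (fs i u))))
    ≤⟨ sumFin-mono n (λ u → *-monoʳ-≤ (a u) (twos≤ u)) ⟩
  sumFin n (λ u → a u * k)
    ≡⟨ sumFin-*ʳ n k a ⟩
  deg G v * k ∎
  where
  open ≤-Reasoning
  a : Fin n → ℕ
  a u = indicator (Adj G v u)

family-size≤deg : ∀ {n} (G : Graph n) k .{{_ : NonZero k}} d fs →
  IsRkkFamily G k d fs → ∀ v → d ≤ deg G v + (k + k)
family-size≤deg G k d fs (isR , _ , weight≤) v = *-cancelʳ-≤ d _ k (begin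
  d * k                                        ≡⟨ sumFin-const d k ⟨
  sumFin d (λ _ → k)                           ≤⟨ sumFin-mono d (λ i → rkdf-local G k (fs i) (isR i) v) ⟩
  sumFin d (λ i → N i + toℕ (fs i v) * k)      ≡⟨ sumFin-+ d N _ ⟩
  sumFin d N + sumFin d (λ i → toℕ (fs i v) * k)
    ≡⟨ cong (sumFin d N +_) (sumFin-*ʳ d k _) ⟩
  sumFin d N + sumFin d (λ i → toℕ (fs i v)) * k
    ≤⟨ +-mono-≤ (twoNeighbours-total≤ G k d fs (twos-at-vertex≤ k d fs weight≤) v)
                (*-monoˡ-≤ k (weight≤ v)) ⟩
  deg G v * k + (k + k) * k                    ≡⟨ *-distribʳ-+ k (deg G v) (k + k) ⟨
  (deg G v + (k + k)) * k                      ∎)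
  where
  open ≤-Reasoning
  N : Fin d → ℕ
  N i = twoNeighbours G (fs i) v

domatic-upper-bound : (n : ℕ) (G : Graph (suc n)) (k : ℕ) → 1 ≤ k →
  (d : ℕ) (fs : Fin d → Fin (suc n) → Fin 3) → IsRkkFamily G k d fs →
  d ≤ δ G + (k + k)
domatic-upper-bound n G k@(suc _) _ d fs family =
  subst (λ m → d ≤ m + (k + k)) (sym δ≡deg-v) (family-size≤deg G k d fs family v)
  where
  v : Fin (suc n)
  v = proj₁ (minFin-attained n (deg G))
  δ≡deg-v : δ G ≡ deg G v
  δ≡deg-v = proj₂ (minFin-attained n (deg G))

-- The extremal graph: an isolated vertex plus the complete 2k-partite
-- graph K_{k,…,k}, whose vertices are Fin (2k · k) indexed by combine.

module Extremal (k-1 : ℕ) where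

  k parts n : ℕ
  k     = suc k-1
  parts = k + k
  n     = parts * k

  part : Fin n → Fin parts
  part u = proj₁ (remQuot k u)

  part-combine : ∀ (i : Fin parts) (j : Fin k) → part (combine i j) ≡ i
  part-combine i j = cong proj₁ (remQuot-combine i j)

  adj : Fin (suc n) → Fin (suc n) → Bool
  adj F.zero    _         = false
  adj (F.suc a) F.zero    = false
  adj (F.suc a) (F.suc b) = not (does (part a ≟ part b))

  adj-sym : ∀ u v → adj u v ≡ adj v u
  adj-sym F.zero    F.zero    = refl
  adj-sym F.zero    (F.suc b) = refl
  adj-sym (F.suc a) F.zero    = refl
  adj-sym (F.suc a) (F.suc b) = cong not (does-⇔ (mk⇔ sym sym) (part a ≟ part b) (part b ≟ part a))

  adj-irrefl : ∀ v → adj v v ≡ false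
  adj-irrefl F.zero    = refl
  adj-irrefl (F.suc a) = cong not (dec-true (part a ≟ part a) refl)

  G : Graph (suc n)
  G = record { Adj = adj ; sym = adj-sym ; irrfl = adj-irrefl }

  δ≡0 : δ G ≡ 0
  δ≡0 = minFin-zero n (deg G) (trans (sumFin-const (suc n) 0) (*-zeroʳ (suc n)))

  two : Fin 3
  two = F.suc (F.suc F.zero)

  label : Bool → Fin 3
  label b = if b then two else F.zero

  f : Fin parts → Fin (suc n) → Fin 3
  f i F.zero    = F.suc F.zero
  f i (F.suc a) = label (does (part a ≟ i))

  two-neighbour : ∀ i a (j : Fin k) → part a ≢ i →
    indicator (adj (F.suc a) (F.suc (combine i j)) ∧ is2 (f i (F.suc (combine i j)))) ≡ 1
  two-neighbour i a j a∉i
    rewrite part-combine i j | dec-false (part a ≟ i) a∉i | dec-true (i ≟ i) refl = refl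

  f-rkdf : ∀ i → IsRkDF G k (f i)
  f-rkdf i F.zero    ()
  f-rkdf i (F.suc a) f≡0 with part a ≟ i
  ... | yes _ with () ← f≡0
  ... | no a∉i = begin
    k                                                   ≡⟨ *-identityʳ k ⟨
    k * 1                                               ≡⟨ sumFin-const k 1 ⟨
    sumFin k (λ _ → 1)                                  ≡⟨ sumFin-cong k (λ j → two-neighbour i a j a∉i) ⟨
    sumFin k (λ j → h (combine i j))                    ≤⟨ term≤sumFin parts (λ x → sumFin k (λ j → h (combine x j))) i ⟩
    sumFin parts (λ x → sumFin k (λ j → h (combine x j))) ≡⟨ sumFin-combine parts k h ⟨
    sumFin n h                                          ∎
    where
    open ≤-Reasoning
    h : Fin n → ℕ
    h u = indicator (adj (F.suc a) (F.suc u) ∧ is2 (f i (F.suc u)))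

  f-on-part : ∀ i j x → f j (F.suc (combine i x)) ≡ label (does (i ≟ j))
  f-on-part i j x = cong (λ p → label (does (p ≟ j))) (part-combine i x)

  f-distinct : ∀ i j → i ≢ j → ¬ (∀ v → f i v ≡ f j v)
  f-distinct i j i≢j f≗ = two≢zero (begin
    two                                   ≡⟨ cong label (dec-true (i ≟ i) refl) ⟨
    label (does (i ≟ i))                  ≡⟨ f-on-part i i F.zero ⟨
    f i (F.suc (combine i F.zero))        ≡⟨ f≗ (F.suc (combine i F.zero)) ⟩
    f j (F.suc (combine i F.zero))        ≡⟨ f-on-part i j F.zero ⟩
    label (does (i ≟ j))                  ≡⟨ cong label (dec-false (i ≟ j) i≢j) ⟩
    F.zero                                ∎)
    where
    open ≡-Reasoning
    two≢zero : two ≢ F.zero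
    two≢zero ()

  f-weight : ∀ v → sumFin parts (λ i → toℕ (f i v)) ≤ k + k
  f-weight F.zero    = ≤-reflexive (trans (sumFin-const parts 1) (*-identityʳ parts))
  f-weight (F.suc a) = begin
    sumFin parts (λ i → toℕ (label (does (part a ≟ i))))  ≡⟨ sumFin-cong parts (λ i → toℕ-label (does (part a ≟ i))) ⟩
    sumFin parts (λ i → if does (part a ≟ i) then 2 else 0) ≡⟨ sumFin-delta parts (part a) 2 ⟩
    2                                                     ≤⟨ +-mono-≤ (s≤s z≤n) (s≤s z≤n) ⟩
    k + k                                                 ∎
    where
    open ≤-Reasoning
    toℕ-label : ∀ b → toℕ (label b) ≡ (if b then 2 else 0)
    toℕ-label true  = refl
    toℕ-label false = refl

  family : IsRkkFamily G k parts f
  family = f-rkdf , f-distinct , f-weight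

  extremal : IsRomanKDomaticNumber G k (δ G + (k + k))
  extremal = subst (λ m → Σ (Fin (m + (k + k)) → Fin (suc n) → Fin 3) (IsRkkFamily G k (m + (k + k))))
                   (sym δ≡0) (f , family)
           , domatic-upper-bound n G k (s≤s z≤n)

theorem5 :
    ((n : ℕ) (G : Graph (suc n)) (k : ℕ) → 1 ≤ k →
      (d : ℕ) (fs : Fin d → Fin (suc n) → Fin 3) → IsRkkFamily G k d fs →
      d ≤ δ G + (k + k))
    × ((k : ℕ) → 1 ≤ k →
      Σ ℕ (λ n → Σ (Graph (suc n)) (λ G →
        IsRomanKDomaticNumber G k (δ G + (k + k)))))
theorem5 = domatic-upper-bound , sharpness
  where
  sharpness : (k : ℕ) → 1 ≤ k →
    Σ ℕ (λ n → Σ (Graph (suc n)) (λ G → IsRomanKDomaticNumber G k (δ G + (k + k))))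
  sharpness (suc k-1) _ = Extremal.n k-1 , Extremal.G k-1 , Extremal.extremal k-1
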